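{- Let $p$ be a prime and let $d\in\mathbb{F}_p[x]$ be a self-reciprocal polynomial of even degree. Then $\phi_p((x+1)d)=\phi_p((x+1)^2d)$ and $\phi_p((x-1)d)=\phi_p((x-1)^2d)$.
   Context: For $f\in\mathbb{F}_p[x]$ with $f(0)\ne0$, $f^*(x)=x^{\deg f}f(1/x)$; a nonzero polynomial $g$ is self-reciprocal if $g^*=g$. For $f\in\mathbb{F}_p[x]$, $K(f)$ is the set of nonzero self-reciprocal $g\in\mathbb{F}_p[x]$ of even degree (nonzero constants have degree $0$) with $\deg g<\deg f$ and $\gcd(g,f)=1$, and $\phi_p(f)=|K(f)|$. -}

module Defs where

open import Data.Nat using (ℕ; zero; suc; _+_; _*_; _∸_; _<_)
open import Data.Nat.DivMod using (_%_)
open import Data.List using (List; []; _∷_; length; map; foldr; reverse)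
open import Data.List.Relation.Unary.All using (All)
open import Data.List.Relation.Unary.Unique.Propositional using (Unique)
open import Data.List.Membership.Propositional using (_∈_)
open import Data.Product using (Σ; ∃; _×_; _,_)
open import Data.Empty using (⊥)
open import Relation.Nullary using (¬_)
open import Relation.Binary.PropositionalEquality using (_≡_)
open import Function.Bundles using (_⇔_)

-- Polynomials over F_p are represented as coefficient lists in ℕ,
-- lowest degree first: [a₀, a₁, …, aₙ] stands for a₀ + a₁x + … + aₙxⁿ.
-- A *canonical* polynomial has every coefficient < p and no trailing
-- zero (so the zero polynomial is [] and the representation is unique).

modP : ℕ → ℕ → ℕ
modP zero    m = m
modP (suc k) m = m % suc k

consT : ℕ → List ℕ → List ℕ
consT zero    [] = []
consT (suc a) [] = suc a ∷ []
consT a (y ∷ ys) = a ∷ y ∷ ys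

trim : List ℕ → List ℕ
trim []       = []
trim (x ∷ xs) = consT x (trim xs)

canon : ℕ → List ℕ → List ℕ
canon p xs = trim (map (modP p) xs)

NoTrailingZero : List ℕ → Set
NoTrailingZero xs = trim xs ≡ xs

IsPoly : ℕ → List ℕ → Set
IsPoly p xs = All (_< p) xs × NoTrailingZero xs

addL : List ℕ → List ℕ → List ℕ
addL []       ys       = ys
addL (x ∷ xs) []       = x ∷ xs
addL (x ∷ xs) (y ∷ ys) = (x + y) ∷ addL xs ys

mulL : List ℕ → List ℕ → List ℕ
mulL xs ys = foldr (λ a acc → addL (map (a *_) ys) (0 ∷ acc)) [] xs

pmul : ℕ → List ℕ → List ℕ → List ℕ
pmul p f g = canon p (mulL f g)

-- degree of a nonzero polynomial (the zero polynomial [] is never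
-- used where its degree matters; nonzero constants have degree 0)
deg : List ℕ → ℕ
deg xs = length xs ∸ 1

Even : ℕ → Set
Even n = ∃ λ k → n ≡ 2 * k

-- reciprocal f*(x) = x^{deg f} f(1/x): reverse the coefficient list
-- (then trim; when f(0) ≠ 0 nothing is trimmed).
recip : List ℕ → List ℕ
recip xs = trim (reverse xs)

SelfReciprocal : List ℕ → Set
SelfReciprocal g = ¬ (g ≡ []) × recip g ≡ g

Divides : ℕ → List ℕ → List ℕ → Set
Divides p h g = Σ (List ℕ) λ q → IsPoly p q × pmul p h q ≡ g

-- gcd(g, f) = 1: every common divisor is a unit, i.e. has degree 0
Coprime : ℕ → List ℕ → List ℕ → Set
Coprime p g f = (h : List ℕ) → IsPoly p h → ¬ (h ≡ []) →
                Divides p h g → Divides p h f → deg h ≡ 0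

InK : ℕ → List ℕ → List ℕ → Set
InK p f g = IsPoly p g × SelfReciprocal g × Even (deg g)
          × deg g < deg f × Coprime p g f

-- "φ_p(f) = n": the elements of K(f) are exactly the entries of a
-- duplicate-free list of length n, i.e. |K(f)| = n.
PhiIs : ℕ → List ℕ → ℕ → Set
PhiIs p f n = Σ (List (List ℕ)) λ xs →
  Unique xs × length xs ≡ n × ((g : List ℕ) → (g ∈ xs) ⇔ InK p f g)

x+1 : List ℕ
x+1 = 1 ∷ 1 ∷ []

x-1 : ℕ → List ℕ
x-1 p = (p ∸ 1) ∷ 1 ∷ []

-- Let L = x ± 1, a linear polynomial with root r = ∓1, and put f₁ = L·d, f₂ = L²·d.
-- As deg d is even, the bounds deg g < deg d + 1 and deg g < deg d + 2 agree on even
-- degrees. A g coprime to f₂ is coprime to its divisor f₁. Conversely, if g is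
-- coprime to f₁ then g(r) ≠ 0 (else L divides both), so every common divisor h of g
-- and f₂ has h(r) ≠ 0; from h·q = L·f₁ and primality of p we get q(r) = 0, so L ∣ q,
-- and cancelling L gives h ∣ f₁. Hence K(L·d) = K(L²·d). Membership in K(f) is
-- decidable and K(f) lies in a finite set of coefficient lists, so it can be
-- enumerated, which gives the cardinalities.
module Submission where

open import Defs
open import Data.Nat
open import Data.Nat.Properties
open import Data.Nat.DivMod
open import Data.Nat.Divisibility using (divides; _∣?_; m%n≡0⇒n∣m; n∣m⇒m%n≡0)
open import Data.Nat.Primality using (Prime; euclidsLemma; ¬prime[0]; ¬prime[1])
open import Data.Nat.Tactic.RingSolver using (solve-∀)
open import Data.List using (List; []; _∷_; length; map; upTo; cartesianProductWith; filter; deduplicate)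
open import Data.List.Properties using (≡-dec)
open import Data.List.Relation.Unary.All as All using (All; []; _∷_; all?)
open import Data.List.Relation.Unary.Any using (here; there; any?; satisfied)
open import Data.List.Membership.Propositional using (_∈_; lose)
open import Data.List.Membership.Propositional.Properties
  using (∈-upTo⁺; ∈-cartesianProductWith⁺; ∈-filter⁺; ∈-filter⁻; ∈-deduplicate⁺; ∈-deduplicate⁻)
open import Data.List.Relation.Unary.Unique.DecPropositional.Properties using (deduplicate-!)
open import Data.Product using (∃; _×_; _,_; proj₁; proj₂)
open import Data.Sum using (inj₁; inj₂)
open import Data.Empty using (⊥-elim)
open import Function.Bundles using (_⇔_; mk⇔; Equivalence)
open import Level using (0ℓ)
open import Relation.Binary.Bundles using (Setoid)
open import Relation.Binary.PropositionalEquality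
import Relation.Binary.Reasoning.Setoid as SetoidReasoning
open import Relation.Nullary using (¬_; Dec; yes; no)
open import Relation.Nullary.Decidable using (_×-dec_; _→-dec_; ¬?; map′; decidable-stable)

-- Coefficients of integer polynomials

coef : List ℕ → ℕ → ℕ
coef []       _       = 0
coef (x ∷ _)  zero    = x
coef (_ ∷ xs) (suc i) = coef xs i

infix 4 _≐_
_≐_ : List ℕ → List ℕ → Set
a ≐ b = ∀ i → coef a i ≡ coef b i

∷-cong-≐ : ∀ x {a b} → a ≐ b → x ∷ a ≐ x ∷ b
∷-cong-≐ x e zero    = refl
∷-cong-≐ x e (suc i) = e i

coef-addL : ∀ a b i → coef (addL a b) i ≡ coef a i + coef b i
coef-addL []      b       i       = refl
coef-addL (x ∷ a) []      i       = sym (+-identityʳ _)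
coef-addL (x ∷ a) (y ∷ b) zero    = refl
coef-addL (x ∷ a) (y ∷ b) (suc i) = coef-addL a b i

coef-map-* : ∀ k b i → coef (map (k *_) b) i ≡ k * coef b i
coef-map-* k []      i       = sym (*-zeroʳ k)
coef-map-* k (x ∷ b) zero    = refl
coef-map-* k (x ∷ b) (suc i) = coef-map-* k b i

coef-mulL-∷ˡ : ∀ x a b i → coef (mulL (x ∷ a) b) i ≡ x * coef b i + coef (0 ∷ mulL a b) i
coef-mulL-∷ˡ x a b i = begin
  coef (addL (map (x *_) b) (0 ∷ mulL a b)) i        ≡⟨ coef-addL (map (x *_) b) _ i ⟩
  coef (map (x *_) b) i + coef (0 ∷ mulL a b) i      ≡⟨ cong (_+ _) (coef-map-* x b i) ⟩
  x * coef b i + coef (0 ∷ mulL a b) i               ∎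
  where open ≡-Reasoning

coef-mulL-[]ʳ : ∀ a i → coef (mulL a []) i ≡ 0
coef-mulL-[]ʳ []      i       = refl
coef-mulL-[]ʳ (x ∷ a) zero    = refl
coef-mulL-[]ʳ (x ∷ a) (suc i) = coef-mulL-[]ʳ a i

coef-mulL-∷ʳ : ∀ a y b i → coef (mulL a (y ∷ b)) i ≡ y * coef a i + coef (0 ∷ mulL a b) i
coef-mulL-∷ʳ []      y b zero    = sym (trans (+-identityʳ _) (*-zeroʳ y))
coef-mulL-∷ʳ []      y b (suc i) = sym (trans (+-identityʳ _) (*-zeroʳ y))
coef-mulL-∷ʳ (x ∷ a) y b zero    = cong (_+ 0) (*-comm x y)
coef-mulL-∷ʳ (x ∷ a) y b (suc i) = begin
  coef (mulL (x ∷ a) (y ∷ b)) (suc i)                       ≡⟨ coef-mulL-∷ˡ x a (y ∷ b) (suc i) ⟩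
  x * coef b i + coef (mulL a (y ∷ b)) i                   ≡⟨ cong (x * coef b i +_) (coef-mulL-∷ʳ a y b i) ⟩
  x * coef b i + (y * coef a i + coef (0 ∷ mulL a b) i)    ≡⟨ swap (x * coef b i) (y * coef a i) _ ⟩
  y * coef a i + (x * coef b i + coef (0 ∷ mulL a b) i)    ≡⟨ cong (y * coef a i +_) (coef-mulL-∷ˡ x a b i) ⟨
  y * coef a i + coef (mulL (x ∷ a) b) i                   ∎
  where
  open ≡-Reasoning
  swap : ∀ u v w → u + (v + w) ≡ v + (u + w)
  swap = solve-∀

mulL-comm : ∀ a b → mulL a b ≐ mulL b a
mulL-comm []      b i = sym (coef-mulL-[]ʳ b i)
mulL-comm (x ∷ a) b i = begin
  coef (mulL (x ∷ a) b) i                  ≡⟨ coef-mulL-∷ˡ x a b i ⟩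
  x * coef b i + coef (0 ∷ mulL a b) i     ≡⟨ cong (x * coef b i +_) (∷-cong-≐ 0 (mulL-comm a b) i) ⟩
  x * coef b i + coef (0 ∷ mulL b a) i     ≡⟨ coef-mulL-∷ʳ b x a i ⟨
  coef (mulL b (x ∷ a)) i                  ∎
  where open ≡-Reasoning

mulL-distribʳ-addL : ∀ a a′ b → mulL (addL a a′) b ≐ addL (mulL a b) (mulL a′ b)
mulL-distribʳ-addL []      a′       b i = refl
mulL-distribʳ-addL (x ∷ a) []       b i = sym (trans (coef-addL (mulL (x ∷ a) b) [] i) (+-identityʳ _))
mulL-distribʳ-addL (x ∷ a) (y ∷ a′) b i = begin
  coef (mulL ((x + y) ∷ addL a a′) b) i
    ≡⟨ coef-mulL-∷ˡ (x + y) (addL a a′) b i ⟩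
  (x + y) * coef b i + coef (0 ∷ mulL (addL a a′) b) i
    ≡⟨ cong ((x + y) * coef b i +_) (∷-cong-≐ 0 (mulL-distribʳ-addL a a′ b) i) ⟩
  (x + y) * coef b i + coef (addL (0 ∷ mulL a b) (0 ∷ mulL a′ b)) i
    ≡⟨ cong ((x + y) * coef b i +_) (coef-addL (0 ∷ mulL a b) (0 ∷ mulL a′ b) i) ⟩
  (x + y) * coef b i + (coef (0 ∷ mulL a b) i + coef (0 ∷ mulL a′ b) i)
    ≡⟨ regroup x y (coef b i) _ _ ⟩
  (x * coef b i + coef (0 ∷ mulL a b) i) + (y * coef b i + coef (0 ∷ mulL a′ b) i)
    ≡⟨ cong₂ _+_ (coef-mulL-∷ˡ x a b i) (coef-mulL-∷ˡ y a′ b i) ⟨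
  coef (mulL (x ∷ a) b) i + coef (mulL (y ∷ a′) b) i
    ≡⟨ coef-addL (mulL (x ∷ a) b) (mulL (y ∷ a′) b) i ⟨
  coef (addL (mulL (x ∷ a) b) (mulL (y ∷ a′) b)) i
    ∎
  where
  open ≡-Reasoning
  regroup : ∀ x y u v w → (x + y) * u + (v + w) ≡ (x * u + v) + (y * u + w)
  regroup = solve-∀

mulL-map-*ˡ : ∀ k a b → mulL (map (k *_) a) b ≐ map (k *_) (mulL a b)
mulL-map-*ˡ k []      b i = refl
mulL-map-*ˡ k (x ∷ a) b i = begin
  coef (mulL (k * x ∷ map (k *_) a) b) i
    ≡⟨ coef-mulL-∷ˡ (k * x) (map (k *_) a) b i ⟩
  k * x * coef b i + coef (0 ∷ mulL (map (k *_) a) b) i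
    ≡⟨ cong (k * x * coef b i +_) (∷-cong-≐ 0 (mulL-map-*ˡ k a b) i) ⟩
  k * x * coef b i + coef (0 ∷ map (k *_) (mulL a b)) i
    ≡⟨ cong (k * x * coef b i +_) (shifted i) ⟩
  k * x * coef b i + k * coef (0 ∷ mulL a b) i
    ≡⟨ factor-k k x (coef b i) _ ⟩
  k * (x * coef b i + coef (0 ∷ mulL a b) i)
    ≡⟨ cong (k *_) (coef-mulL-∷ˡ x a b i) ⟨
  k * coef (mulL (x ∷ a) b) i
    ≡⟨ coef-map-* k (mulL (x ∷ a) b) i ⟨
  coef (map (k *_) (mulL (x ∷ a) b)) i
    ∎
  where
  open ≡-Reasoning
  factor-k : ∀ k x u v → k * x * u + k * v ≡ k * (x * u + v)
  factor-k = solve-∀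
  shifted : ∀ i → coef (0 ∷ map (k *_) (mulL a b)) i ≡ k * coef (0 ∷ mulL a b) i
  shifted zero    = sym (*-zeroʳ k)
  shifted (suc i) = coef-map-* k (mulL a b) i

mulL-assoc : ∀ a b c → mulL (mulL a b) c ≐ mulL a (mulL b c)
mulL-assoc []      b c i = refl
mulL-assoc (x ∷ a) b c i = begin
  coef (mulL (addL (map (x *_) b) (0 ∷ mulL a b)) c) i
    ≡⟨ mulL-distribʳ-addL (map (x *_) b) (0 ∷ mulL a b) c i ⟩
  coef (addL (mulL (map (x *_) b) c) (mulL (0 ∷ mulL a b) c)) i
    ≡⟨ coef-addL (mulL (map (x *_) b) c) (mulL (0 ∷ mulL a b) c) i ⟩
  coef (mulL (map (x *_) b) c) i + coef (mulL (0 ∷ mulL a b) c) i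
    ≡⟨ cong₂ _+_ (trans (mulL-map-*ˡ x b c i) (coef-map-* x (mulL b c) i)) (coef-mulL-∷ˡ 0 (mulL a b) c i) ⟩
  x * coef (mulL b c) i + coef (0 ∷ mulL (mulL a b) c) i
    ≡⟨ cong (x * coef (mulL b c) i +_) (∷-cong-≐ 0 (mulL-assoc a b c) i) ⟩
  x * coef (mulL b c) i + coef (0 ∷ mulL a (mulL b c)) i
    ≡⟨ coef-mulL-∷ˡ x a (mulL b c) i ⟨
  coef (mulL (x ∷ a) (mulL b c)) i
    ∎
  where open ≡-Reasoning

-- Canonical representatives

consT-∷⁻ : ∀ y t {u us} → consT y t ≡ y ∷ u ∷ us → t ≡ u ∷ us
consT-∷⁻ zero    (_ ∷ _) refl = refl
consT-∷⁻ (suc y) (_ ∷ _) refl = refl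

noTrailingZero-tail : ∀ y z zs → NoTrailingZero (y ∷ z ∷ zs) → NoTrailingZero (z ∷ zs)
noTrailingZero-tail y z zs = consT-∷⁻ y (trim (z ∷ zs))

lead : List ℕ → ℕ
lead xs = coef xs (deg xs)

lead≢0 : ∀ xs → NoTrailingZero xs → ¬ xs ≡ [] → ¬ lead xs ≡ 0
lead≢0 []           _  ne = ⊥-elim (ne refl)
lead≢0 (zero ∷ [])  () _
lead≢0 (suc y ∷ []) _  _  ()
lead≢0 (y ∷ z ∷ zs) nz _  = lead≢0 (z ∷ zs) (noTrailingZero-tail y z zs nz) (λ ())

coef-[0] : ∀ i → coef (0 ∷ []) i ≡ 0
coef-[0] zero    = refl
coef-[0] (suc i) = refl

length≤suc-deg : ∀ xs → length xs ≤ suc (deg xs)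
length≤suc-deg []      = z≤n
length≤suc-deg (_ ∷ _) = ≤-refl

coef-≥length : ∀ xs i → length xs ≤ i → coef xs i ≡ 0
coef-≥length []       i       _         = refl
coef-≥length (x ∷ xs) (suc i) (s≤s le) = coef-≥length xs i le

coef≢0⇒<length : ∀ xs i → ¬ coef xs i ≡ 0 → i < length xs
coef≢0⇒<length xs i nz with length xs ≤? i
... | yes le = ⊥-elim (nz (coef-≥length xs i le))
... | no  gt = ≰⇒> gt

noTrailingZero-length≤ : ∀ xs n → NoTrailingZero xs → (∀ i → n < i → coef xs i ≡ 0) → length xs ≤ suc n
noTrailingZero-length≤ []            n _  _    = z≤n
noTrailingZero-length≤ xs@(_ ∷ xs′) n nz high with length xs′ ≤? n
... | yes le = s≤s le
... | no  gt = ⊥-elim (lead≢0 xs nz (λ ()) (high (length xs′) (≰⇒> gt)))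

noTrailingZero-≐⇒≡ : ∀ a b → NoTrailingZero a → NoTrailingZero b → a ≐ b → a ≡ b
noTrailingZero-≐⇒≡ [] [] _ _ _ = refl
noTrailingZero-≐⇒≡ [] b@(_ ∷ _) _ nb e = ⊥-elim (lead≢0 b nb (λ ()) (sym (e (deg b))))
noTrailingZero-≐⇒≡ a@(_ ∷ _) [] na _ e = ⊥-elim (lead≢0 a na (λ ()) (e (deg a)))
noTrailingZero-≐⇒≡ (x ∷ []) (y ∷ []) _ _ e = cong (_∷ []) (e 0)
noTrailingZero-≐⇒≡ (x ∷ []) (y ∷ z ∷ zs) _ nb e =
  ⊥-elim (lead≢0 (z ∷ zs) (noTrailingZero-tail y z zs nb) (λ ()) (sym (e (suc (deg (z ∷ zs))))))
noTrailingZero-≐⇒≡ (x ∷ z ∷ zs) (y ∷ []) na _ e =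
  ⊥-elim (lead≢0 (z ∷ zs) (noTrailingZero-tail x z zs na) (λ ()) (e (suc (deg (z ∷ zs)))))
noTrailingZero-≐⇒≡ (x ∷ z ∷ zs) (y ∷ w ∷ ws) na nb e =
  cong₂ _∷_ (e 0) (noTrailingZero-≐⇒≡ (z ∷ zs) (w ∷ ws)
    (noTrailingZero-tail x z zs na) (noTrailingZero-tail y w ws nb) (λ i → e (suc i)))

coef-consT : ∀ x ys → consT x ys ≐ x ∷ ys
coef-consT zero    []       i = sym (coef-[0] i)
coef-consT (suc x) []       i = refl
coef-consT zero    (y ∷ ys) i = refl
coef-consT (suc x) (y ∷ ys) i = refl

coef-trim : ∀ xs → trim xs ≐ xs
coef-trim []       i = refl
coef-trim (x ∷ xs) i = trans (coef-consT x (trim xs) i) (∷-cong-≐ x (coef-trim xs) i)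

trim-consT : ∀ x ys → trim (consT x ys) ≡ consT x (trim ys)
trim-consT zero    []       = refl
trim-consT (suc x) []       = refl
trim-consT zero    (y ∷ ys) = refl
trim-consT (suc x) (y ∷ ys) = refl

trim-idem : ∀ xs → trim (trim xs) ≡ trim xs
trim-idem []       = refl
trim-idem (x ∷ xs) = trans (trim-consT x (trim xs)) (cong (consT x) (trim-idem xs))

All-consT : ∀ {Q : ℕ → Set} x ys → All Q (x ∷ ys) → All Q (consT x ys)
All-consT zero    []       _ = []
All-consT (suc x) []       a = a
All-consT zero    (y ∷ ys) a = a
All-consT (suc x) (y ∷ ys) a = a

All-trim : ∀ {Q : ℕ → Set} xs → All Q xs → All Q (trim xs)
All-trim []       []       = []
All-trim (x ∷ xs) (q ∷ qs) = All-consT x (trim xs) (q ∷ All-trim xs qs)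

-- Arithmetic in 𝔽_P[x]

module Modulo (k : ℕ) where
  P : ℕ
  P = suc k

  infix 4 _≡ₚ_ _≈_
  -- A record rather than a synonym for a % P ≡ b % P, so that a and b can be inferred.
  record _≡ₚ_ (a b : ℕ) : Set where
    constructor mkₚ
    field unₚ : a % P ≡ b % P
  open _≡ₚ_ public

  ≡ₚ-setoid : Setoid 0ℓ 0ℓ
  ≡ₚ-setoid = record
    { Carrier       = ℕ
    ; _≈_           = _≡ₚ_
    ; isEquivalence = record
      { refl  = mkₚ refl
      ; sym   = λ (mkₚ e) → mkₚ (sym e)
      ; trans = λ (mkₚ e) (mkₚ e′) → mkₚ (trans e e′)
      }
    }

  open Setoid ≡ₚ-setoid public using () renaming (refl to ≡ₚ-refl; sym to ≡ₚ-sym; trans to ≡ₚ-trans)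
  module ≡ₚ-Reasoning = SetoidReasoning ≡ₚ-setoid

  ≡⇒≡ₚ : ∀ {a b} → a ≡ b → a ≡ₚ b
  ≡⇒≡ₚ e = mkₚ (cong (_% P) e)

  +-congₚ : ∀ {a b c d} → a ≡ₚ b → c ≡ₚ d → a + c ≡ₚ b + d
  +-congₚ {a} {b} {c} {d} (mkₚ e) (mkₚ e′) = mkₚ (begin
    (a + c) % P             ≡⟨ %-distribˡ-+ a c P ⟩
    (a % P + c % P) % P     ≡⟨ cong₂ (λ u v → (u + v) % P) e e′ ⟩
    (b % P + d % P) % P     ≡⟨ %-distribˡ-+ b d P ⟨
    (b + d) % P             ∎)
    where open ≡-Reasoning

  *-congₚ : ∀ {a b c d} → a ≡ₚ b → c ≡ₚ d → a * c ≡ₚ b * d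
  *-congₚ {a} {b} {c} {d} (mkₚ e) (mkₚ e′) = mkₚ (begin
    (a * c) % P             ≡⟨ %-distribˡ-* a c P ⟩
    (a % P * (c % P)) % P   ≡⟨ cong₂ (λ u v → (u * v) % P) e e′ ⟩
    (b % P * (d % P)) % P   ≡⟨ %-distribˡ-* b d P ⟨
    (b * d) % P             ∎)
    where open ≡-Reasoning

  m%P≡ₚm : ∀ m → m % P ≡ₚ m
  m%P≡ₚm m = mkₚ (m%n%n≡m%n m P)

  m+kP≡ₚm : ∀ m j → m + j * P ≡ₚ m
  m+kP≡ₚm m j = mkₚ ([m+kn]%n≡m%n m j P)

  P∸m%P+m≡ₚ0 : ∀ m → (P ∸ m % P) + m ≡ₚ 0
  P∸m%P+m≡ₚ0 m = begin
    (P ∸ m % P) + m        ≈⟨ +-congₚ {P ∸ m % P} ≡ₚ-refl (≡ₚ-sym (m%P≡ₚm m)) ⟩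
    (P ∸ m % P) + m % P    ≡⟨ m∸n+n≡m (<⇒≤ (m%n<n m P)) ⟩
    P                      ≈⟨ mkₚ (n%n≡0 P) ⟩
    0                      ∎
    where open ≡ₚ-Reasoning

  +-cancelˡ-≡ₚ : ∀ x {y z} → x + y ≡ₚ x + z → y ≡ₚ z
  +-cancelˡ-≡ₚ x {y} {z} e = begin
    y                            ≈⟨ +-congₚ {0} (≡ₚ-sym (P∸m%P+m≡ₚ0 x)) (≡ₚ-refl {y}) ⟩
    (P ∸ x % P) + x + y          ≡⟨ +-assoc (P ∸ x % P) x y ⟩
    (P ∸ x % P) + (x + y)        ≈⟨ +-congₚ {P ∸ x % P} ≡ₚ-refl e ⟩
    (P ∸ x % P) + (x + z)        ≡⟨ +-assoc (P ∸ x % P) x z ⟨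
    (P ∸ x % P) + x + z          ≈⟨ +-congₚ (P∸m%P+m≡ₚ0 x) (≡ₚ-refl {z}) ⟩
    z                            ∎
    where open ≡ₚ-Reasoning

  _≈_ : List ℕ → List ℕ → Set
  a ≈ b = ∀ i → coef a i ≡ₚ coef b i

  ∷-cong-≈ : ∀ x {a b} → a ≈ b → x ∷ a ≈ x ∷ b
  ∷-cong-≈ x e zero    = ≡ₚ-refl
  ∷-cong-≈ x e (suc i) = e i

  coef-map-modP : ∀ xs i → coef (map (modP P) xs) i ≡ coef xs i % P
  coef-map-modP []       i       = refl
  coef-map-modP (x ∷ xs) zero    = refl
  coef-map-modP (x ∷ xs) (suc i) = coef-map-modP xs i

  coef-canon : ∀ xs i → coef (canon P xs) i ≡ coef xs i % P
  coef-canon xs i = trans (coef-trim (map (modP P) xs) i) (coef-map-modP xs i)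

  canon-≈ : ∀ xs → canon P xs ≈ xs
  canon-≈ xs i = ≡ₚ-trans (≡⇒≡ₚ (coef-canon xs i)) (m%P≡ₚm (coef xs i))

  canon-IsPoly : ∀ xs → IsPoly P (canon P xs)
  canon-IsPoly xs = All-trim (map (modP P) xs) (all< xs) , trim-idem (map (modP P) xs)
    where
    all< : ∀ xs → All (_< P) (map (modP P) xs)
    all< []       = []
    all< (x ∷ xs) = m%n<n x P ∷ all< xs

  canon-id : ∀ xs → IsPoly P xs → canon P xs ≡ xs
  canon-id xs (all< , nz) = trans (cong trim (map-id xs all<)) nz
    where
    map-id : ∀ xs → All (_< P) xs → map (modP P) xs ≡ xs
    map-id []       []         = refl
    map-id (x ∷ xs) (x< ∷ xs<) = cong₂ _∷_ (m<n⇒m%n≡m x<) (map-id xs xs<)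

  ≈⇒canon≡ : ∀ a b → a ≈ b → canon P a ≡ canon P b
  ≈⇒canon≡ a b e = noTrailingZero-≐⇒≡ (canon P a) (canon P b)
    (trim-idem (map (modP P) a)) (trim-idem (map (modP P) b))
    (λ i → trans (coef-canon a i) (trans (unₚ (e i)) (sym (coef-canon b i))))

  canon≡⇒≈ : ∀ a b → canon P a ≡ canon P b → a ≈ b
  canon≡⇒≈ a b e i = mkₚ (trans (sym (coef-canon a i)) (trans (cong (λ t → coef t i) e) (coef-canon b i)))

  mulL-congʳ-≈ : ∀ a {b b′} → b ≈ b′ → mulL a b ≈ mulL a b′
  mulL-congʳ-≈ []      e i = ≡ₚ-refl
  mulL-congʳ-≈ (x ∷ a) {b} {b′} e i = begin
    coef (mulL (x ∷ a) b) i                 ≡⟨ coef-mulL-∷ˡ x a b i ⟩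
    x * coef b i + coef (0 ∷ mulL a b) i    ≈⟨ +-congₚ (*-congₚ {x} ≡ₚ-refl (e i)) (∷-cong-≈ 0 (mulL-congʳ-≈ a e) i) ⟩
    x * coef b′ i + coef (0 ∷ mulL a b′) i  ≡⟨ coef-mulL-∷ˡ x a b′ i ⟨
    coef (mulL (x ∷ a) b′) i                ∎
    where open ≡ₚ-Reasoning

  mulL-congˡ-≈ : ∀ {a a′} b → a ≈ a′ → mulL a b ≈ mulL a′ b
  mulL-congˡ-≈ {a} {a′} b e i =
    ≡ₚ-trans (≡⇒≡ₚ (mulL-comm a b i)) (≡ₚ-trans (mulL-congʳ-≈ b e i) (≡⇒≡ₚ (mulL-comm b a′ i)))

  pmul-IsPoly : ∀ a b → IsPoly P (pmul P a b)
  pmul-IsPoly a b = canon-IsPoly (mulL a b)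

  pmul-comm : ∀ a b → pmul P a b ≡ pmul P b a
  pmul-comm a b = ≈⇒canon≡ (mulL a b) (mulL b a) (λ i → ≡⇒≡ₚ (mulL-comm a b i))

  pmul-assoc : ∀ a b c → pmul P (pmul P a b) c ≡ pmul P a (pmul P b c)
  pmul-assoc a b c = ≈⇒canon≡ (mulL (pmul P a b) c) (mulL a (pmul P b c)) λ i → begin
    coef (mulL (canon P (mulL a b)) c) i    ≈⟨ mulL-congˡ-≈ {canon P (mulL a b)} {mulL a b} c (canon-≈ (mulL a b)) i ⟩
    coef (mulL (mulL a b) c) i              ≡⟨ mulL-assoc a b c i ⟩
    coef (mulL a (mulL b c)) i              ≈⟨ mulL-congʳ-≈ a {mulL b c} (λ j → ≡ₚ-sym (canon-≈ (mulL b c) j)) i ⟩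
    coef (mulL a (canon P (mulL b c))) i    ∎
    where open ≡ₚ-Reasoning

  pmul-left-comm : ∀ a b c → pmul P a (pmul P b c) ≡ pmul P b (pmul P a c)
  pmul-left-comm a b c = begin
    pmul P a (pmul P b c)    ≡⟨ pmul-assoc a b c ⟨
    pmul P (pmul P a b) c    ≡⟨ cong (λ t → pmul P t c) (pmul-comm a b) ⟩
    pmul P (pmul P b a) c    ≡⟨ pmul-assoc b a c ⟩
    pmul P b (pmul P a c)    ∎
    where open ≡-Reasoning

coef-mulL-≥length : ∀ a b i → length a + length b ≤ suc i → coef (mulL a b) i ≡ 0
coef-mulL-≥length []      b i       _  = refl
coef-mulL-≥length (x ∷ a) b i le = begin
  coef (mulL (x ∷ a) b) i                 ≡⟨ coef-mulL-∷ˡ x a b i ⟩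
  x * coef b i + coef (0 ∷ mulL a b) i    ≡⟨ cong₂ (λ u v → x * u + v) b-vanishes (shifted i (≤-pred le)) ⟩
  x * 0 + 0                               ≡⟨ cong (_+ 0) (*-zeroʳ x) ⟩
  0                                       ∎
  where
  open ≡-Reasoning
  b-vanishes : coef b i ≡ 0
  b-vanishes = coef-≥length b i (m+n≤o⇒n≤o (length a) (≤-pred le))
  shifted : ∀ i → length a + length b ≤ i → coef (0 ∷ mulL a b) i ≡ 0
  shifted zero    _  = refl
  shifted (suc i) le = coef-mulL-≥length a b i le

coef-mulL-deg+deg : ∀ a b → ¬ a ≡ [] → coef (mulL a b) (deg a + deg b) ≡ lead a * lead b
coef-mulL-deg+deg []          b na = ⊥-elim (na refl)
coef-mulL-deg+deg (x ∷ [])    b _  = begin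
  coef (mulL (x ∷ []) b) (deg b)               ≡⟨ coef-mulL-∷ˡ x [] b (deg b) ⟩
  x * coef b (deg b) + coef (0 ∷ []) (deg b)   ≡⟨ cong (x * coef b (deg b) +_) (coef-[0] (deg b)) ⟩
  x * coef b (deg b) + 0                       ≡⟨ +-identityʳ _ ⟩
  x * coef b (deg b)                           ∎
  where open ≡-Reasoning
coef-mulL-deg+deg (x ∷ y ∷ a) b _  = begin
  coef (mulL (x ∷ y ∷ a) b) (suc (length a + deg b))
    ≡⟨ coef-mulL-∷ˡ x (y ∷ a) b _ ⟩
  x * coef b (suc (length a + deg b)) + coef (mulL (y ∷ a) b) (deg (y ∷ a) + deg b)
    ≡⟨ cong₂ (λ u v → x * u + v) b-vanishes (coef-mulL-deg+deg (y ∷ a) b (λ ())) ⟩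
  x * 0 + lead (y ∷ a) * lead b
    ≡⟨ cong (_+ lead (y ∷ a) * lead b) (*-zeroʳ x) ⟩
  lead (y ∷ a) * lead b
    ∎
  where
  open ≡-Reasoning
  b-vanishes : coef b (suc (length a + deg b)) ≡ 0
  b-vanishes = coef-≥length b _ (≤-trans (length≤suc-deg b) (s≤s (m≤n+m (deg b) (length a))))

module PrimeModulus (k : ℕ) (P-prime : Prime (suc k)) where
  open Modulo k

  *-≢0-mod : ∀ a b → ¬ a % P ≡ 0 → ¬ b % P ≡ 0 → ¬ (a * b) % P ≡ 0
  *-≢0-mod a b a≢0 b≢0 ab≡0 with euclidsLemma a b P-prime (m%n≡0⇒n∣m (a * b) P ab≡0)
  ... | inj₁ P∣a = a≢0 (n∣m⇒m%n≡0 a P P∣a)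
  ... | inj₂ P∣b = b≢0 (n∣m⇒m%n≡0 b P P∣b)

  lead%P≢0 : ∀ xs → IsPoly P xs → ¬ xs ≡ [] → ¬ lead xs % P ≡ 0
  lead%P≢0 xs (all< , nz) ne e = lead≢0 xs nz ne (trans (sym (m<n⇒m%n≡m (coef<P xs (deg xs) all<))) e)
    where
    coef<P : ∀ xs i → All (_< P) xs → coef xs i < P
    coef<P []       i       []        = s≤s z≤n
    coef<P (x ∷ xs) zero    (x< ∷ _)  = x<
    coef<P (x ∷ xs) (suc i) (_ ∷ xs<) = coef<P xs i xs<

  length-canon : ∀ X n → ¬ coef X n % P ≡ 0 → (∀ i → n < i → coef X i % P ≡ 0) → length (canon P X) ≡ suc n
  length-canon X n nz high = ≤-antisym
    (noTrailingZero-length≤ (canon P X) n (trim-idem (map (modP P) X)) (λ i lt → trans (coef-canon X i) (high i lt)))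
    (coef≢0⇒<length (canon P X) n (λ e → nz (trans (sym (coef-canon X n)) e)))

  length-pmul : ∀ h q → IsPoly P h → IsPoly P q → ¬ h ≡ [] → ¬ q ≡ [] →
                length (pmul P h q) ≡ suc (deg h + deg q)
  length-pmul h q ih iq nh nq = length-canon (mulL h q) (deg h + deg q)
    (λ e → *-≢0-mod (lead h) (lead q) (lead%P≢0 h ih nh) (lead%P≢0 q iq nq)
             (trans (cong (_% P) (sym (coef-mulL-deg+deg h q nh))) e))
    (λ i lt → cong (_% P) (coef-mulL-≥length h q i (length≤ h q nh nq i lt)))
    where
    length≤ : ∀ h q → ¬ h ≡ [] → ¬ q ≡ [] → ∀ i → deg h + deg q < i → length h + length q ≤ suc i
    length≤ []       _        nh _  _ _  = ⊥-elim (nh refl)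
    length≤ (_ ∷ _)  []       _  nq _ _  = ⊥-elim (nq refl)
    length≤ (_ ∷ hs) (_ ∷ qs) _  _  i lt = s≤s (subst (_≤ i) (sym (+-suc (length hs) (length qs))) lt)

  pmul-[]ʳ : ∀ h → pmul P h [] ≡ []
  pmul-[]ʳ h = noTrailingZero-≐⇒≡ (pmul P h []) [] (trim-idem (map (modP P) (mulL h []))) refl
    (λ i → trans (coef-canon (mulL h []) i) (cong (_% P) (coef-mulL-[]ʳ h i)))

-- Evaluation and the linear factor

module Horner (r : ℕ) where
  eval : List ℕ → ℕ
  eval []       = 0
  eval (x ∷ xs) = x + r * eval xs

  eval-addL : ∀ a b → eval (addL a b) ≡ eval a + eval b
  eval-addL []      b       = refl
  eval-addL (x ∷ a) []      = sym (+-identityʳ _)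
  eval-addL (x ∷ a) (y ∷ b) = trans (cong (λ t → x + y + r * t) (eval-addL a b)) (regroup r x y (eval a) (eval b))
    where
    -- r is quantified again because solve-∀ only proves closed goals.
    regroup : ∀ r x y u v → x + y + r * (u + v) ≡ x + r * u + (y + r * v)
    regroup = solve-∀

  eval-map-* : ∀ k a → eval (map (k *_) a) ≡ k * eval a
  eval-map-* k []      = sym (*-zeroʳ k)
  eval-map-* k (x ∷ a) = trans (cong (λ t → k * x + r * t) (eval-map-* k a)) (factor-k r k x (eval a))
    where
    factor-k : ∀ r k x u → k * x + r * (k * u) ≡ k * (x + r * u)
    factor-k = solve-∀

  eval-mulL : ∀ a b → eval (mulL a b) ≡ eval a * eval b
  eval-mulL []      b = refl
  eval-mulL (x ∷ a) b = begin
    eval (addL (map (x *_) b) (0 ∷ mulL a b))      ≡⟨ eval-addL (map (x *_) b) (0 ∷ mulL a b) ⟩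
    eval (map (x *_) b) + (0 + r * eval (mulL a b)) ≡⟨ cong₂ (λ u v → u + r * v) (eval-map-* x b) (eval-mulL a b) ⟩
    x * eval b + r * (eval a * eval b)             ≡⟨ regroup r x (eval a) (eval b) ⟩
    (x + r * eval a) * eval b                      ∎
    where
    open ≡-Reasoning
    regroup : ∀ r x u v → x * v + r * (u * v) ≡ (x + r * u) * v
    regroup = solve-∀

  eval-consT : ∀ x ys → eval (consT x ys) ≡ eval (x ∷ ys)
  eval-consT zero    []       = sym (*-zeroʳ r)
  eval-consT (suc x) []       = refl
  eval-consT zero    (y ∷ ys) = refl
  eval-consT (suc x) (y ∷ ys) = refl

  eval-trim : ∀ xs → eval (trim xs) ≡ eval xs
  eval-trim []       = refl
  eval-trim (x ∷ xs) = trans (eval-consT x (trim xs)) (cong (λ t → x + r * t) (eval-trim xs))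

-- c + r ≡ P says that r = -c is the root of L = x + c in 𝔽_P.
module LinearFactor (k c r : ℕ) (c+r≡P : c + r ≡ suc k) where
  open Modulo k
  open Horner r

  eval-canon : ∀ xs → eval (canon P xs) ≡ₚ eval xs
  eval-canon xs = ≡ₚ-trans (≡⇒≡ₚ (eval-trim (map (modP P) xs))) (eval-map-modP xs)
    where
    eval-map-modP : ∀ xs → eval (map (modP P) xs) ≡ₚ eval xs
    eval-map-modP []       = ≡ₚ-refl
    eval-map-modP (x ∷ xs) = +-congₚ (m%P≡ₚm x) (*-congₚ {r} ≡ₚ-refl (eval-map-modP xs))

  eval-pmul : ∀ a b → eval (pmul P a b) ≡ₚ eval a * eval b
  eval-pmul a b = ≡ₚ-trans (eval-canon (mulL a b)) (≡⇒≡ₚ (eval-mulL a b))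

  L : List ℕ
  L = c ∷ 1 ∷ []

  eval-L : eval L ≡ₚ 0
  eval-L = begin
    c + r * (1 + r * 0)   ≡⟨ cong (λ t → c + r * (1 + t)) (*-zeroʳ r) ⟩
    c + r * 1             ≡⟨ cong (c +_) (*-identityʳ r) ⟩
    c + r                 ≡⟨ c+r≡P ⟩
    P                     ≈⟨ mkₚ (n%n≡0 P) ⟩
    0                     ∎
    where open ≡ₚ-Reasoning

  coef-mulL-L : ∀ X i → coef (mulL L X) i ≡ c * coef X i + coef (0 ∷ X) i
  coef-mulL-L X i = trans (coef-mulL-∷ˡ c (1 ∷ []) X i) (cong (c * coef X i +_) (∷-cong-≐ 0 one·X i))
    where
    one·X : mulL (1 ∷ []) X ≐ X
    one·X j = trans (coef-mulL-∷ˡ 1 [] X j) (trans (cong₂ _+_ (*-identityˡ (coef X j)) (coef-[0] j)) (+-identityʳ _))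

  quotient : List ℕ → List ℕ
  quotient []       = []
  quotient (a ∷ as) = eval as ∷ quotient as

  division-by-L : ∀ a → addL (mulL L (quotient a)) (eval a ∷ []) ≈ a
  division-by-L a i = ≡ₚ-trans
    (≡⇒≡ₚ (trans (coef-addL (mulL L (quotient a)) (eval a ∷ []) i) (cong (_+ _) (coef-mulL-L (quotient a) i))))
    (by-coef a i)
    where
    by-coef : ∀ a i → c * coef (quotient a) i + coef (0 ∷ quotient a) i + coef (eval a ∷ []) i ≡ₚ coef a i
    by-coef []       zero          = ≡⇒≡ₚ (cong (λ t → t + 0 + 0) (*-zeroʳ c))
    by-coef []       (suc i)       = ≡⇒≡ₚ (cong (λ t → t + 0 + 0) (*-zeroʳ c))
    by-coef (x ∷ as) zero          = begin
      c * eval as + 0 + (x + r * eval as)  ≡⟨ regroup c r x (eval as) ⟩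
      x + eval as * (c + r)                ≡⟨ cong (λ t → x + eval as * t) c+r≡P ⟩
      x + eval as * P                      ≈⟨ m+kP≡ₚm x (eval as) ⟩
      x                                    ∎
      where
      open ≡ₚ-Reasoning
      regroup : ∀ c r x e → c * e + 0 + (x + r * e) ≡ x + e * (c + r)
      regroup = solve-∀
    by-coef (x ∷ as) (suc zero)    = ≡ₚ-trans (≡⇒≡ₚ (swap (c * coef (quotient as) 0) (eval as))) (by-coef as 0)
      where
      swap : ∀ u v → u + v + 0 ≡ u + 0 + v
      swap = solve-∀
    by-coef (x ∷ as) (suc (suc i)) = by-coef as (suc i)

  root⇒L∣ : ∀ q → IsPoly P q → eval q % P ≡ 0 → Divides P L q
  root⇒L∣ q iq root = canon P (quotient q) , canon-IsPoly (quotient q) ,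
    trans (≈⇒canon≡ (mulL L (canon P (quotient q))) q L·q′≈q) (canon-id q iq)
    where
    root-coef : ∀ i → 0 ≡ₚ coef (eval q ∷ []) i
    root-coef zero    = mkₚ (sym root)
    root-coef (suc i) = ≡ₚ-refl
    L·q′≈q : mulL L (canon P (quotient q)) ≈ q
    L·q′≈q i = begin
      coef (mulL L (canon P (quotient q))) i
        ≈⟨ mulL-congʳ-≈ L {canon P (quotient q)} {quotient q} (canon-≈ (quotient q)) i ⟩
      coef (mulL L (quotient q)) i
        ≡⟨ +-identityʳ _ ⟨
      coef (mulL L (quotient q)) i + 0
        ≈⟨ +-congₚ {coef (mulL L (quotient q)) i} ≡ₚ-refl (root-coef i) ⟩
      coef (mulL L (quotient q)) i + coef (eval q ∷ []) i
        ≡⟨ coef-addL (mulL L (quotient q)) (eval q ∷ []) i ⟨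
      coef (addL (mulL L (quotient q)) (eval q ∷ [])) i
        ≈⟨ division-by-L q i ⟩
      coef q i
        ∎
      where open ≡ₚ-Reasoning

  -- The coefficients of a are recovered from those of L·a from the top down,
  -- since (L·a)ᵢ₊₁ = c aᵢ₊₁ + aᵢ.
  L*-cancel : ∀ a b → IsPoly P a → IsPoly P b → pmul P L a ≡ pmul P L b → a ≡ b
  L*-cancel a b ia ib La≡Lb = begin
    a            ≡⟨ canon-id a ia ⟨
    canon P a    ≡⟨ ≈⇒canon≡ a b (λ i → from-top N i (m≤n+m N i)) ⟩
    canon P b    ≡⟨ canon-id b ib ⟩
    b            ∎
    where
    open ≡-Reasoning
    N = length a + length b
    step : ∀ i → c * coef a i + coef (0 ∷ a) i ≡ₚ c * coef b i + coef (0 ∷ b) i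
    step i = ≡ₚ-trans (≡⇒≡ₚ (sym (coef-mulL-L a i)))
               (≡ₚ-trans (canon≡⇒≈ (mulL L a) (mulL L b) La≡Lb i) (≡⇒≡ₚ (coef-mulL-L b i)))
    from-top : ∀ t i → N ≤ i + t → coef a i ≡ₚ coef b i
    from-top zero    i le = ≡⇒≡ₚ (trans (coef-≥length a i (m+n≤o⇒m≤o (length a) N≤i))
                                        (sym (coef-≥length b i (m+n≤o⇒n≤o (length a) N≤i))))
      where
      N≤i : N ≤ i
      N≤i = subst (N ≤_) (+-identityʳ i) le
    from-top (suc t) i le = +-cancelˡ-≡ₚ (c * coef a (suc i))
      (≡ₚ-trans (step (suc i)) (+-congₚ (*-congₚ {c} ≡ₚ-refl (≡ₚ-sym above)) ≡ₚ-refl))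
      where
      above : coef a (suc i) ≡ₚ coef b (suc i)
      above = from-top t (suc i) (subst (N ≤_) (+-suc i t) le)

-- K(L·d) = K(L²·d)

even<2+even⇒<1+ : ∀ {m n} → Even m → Even n → m < 2 + n → m < 1 + n
even<2+even⇒<1+ (a , refl) (b , refl) lt with m<1+n⇒m<n∨m≡n lt
... | inj₁ lt′ = lt′
... | inj₂ eq  = ⊥-elim (even≢odd a b eq)

module SquareOfLinearFactor (k : ℕ) (P-prime : Prime (suc k)) (c r : ℕ) (c+r≡P : c + r ≡ suc k)
                            (L-IsPoly : IsPoly (suc k) (c ∷ 1 ∷ [])) (d : List ℕ) (d-IsPoly : IsPoly (suc k) d) where
  open Modulo k
  open PrimeModulus k P-prime
  open Horner r
  open LinearFactor k c r c+r≡P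

  f₁ f₂ : List ℕ
  f₁ = pmul P L d
  f₂ = pmul P (pmul P L L) d

  f₂≡L·f₁ : f₂ ≡ pmul P L f₁
  f₂≡L·f₁ = pmul-assoc L L d

  eval-divisor≢0 : ∀ h g → Divides P h g → ¬ eval g % P ≡ 0 → ¬ eval h % P ≡ 0
  eval-divisor≢0 h g (q , _ , h·q≡g) g[r]≢0 h[r]≡0 = g[r]≢0 (unₚ (begin
    eval g             ≡⟨ cong eval h·q≡g ⟨
    eval (pmul P h q)  ≈⟨ eval-pmul h q ⟩
    eval h * eval q    ≈⟨ *-congₚ {eval h} {0} (mkₚ h[r]≡0) ≡ₚ-refl ⟩
    0                  ∎))
    where open ≡ₚ-Reasoning

  divides-f₁⇒divides-f₂ : ∀ h → Divides P h f₁ → Divides P h f₂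
  divides-f₁⇒divides-f₂ h (q , iq , h·q≡f₁) =
    pmul P L q , pmul-IsPoly L q , trans (pmul-left-comm h L q) (trans (cong (pmul P L) h·q≡f₁) (sym f₂≡L·f₁))

  -- A divisor h of f₂ = L·f₁ with h[r] ≢ 0 leaves the factor L in the cofactor.
  divides-f₂⇒divides-f₁ : ∀ h → ¬ eval h % P ≡ 0 → Divides P h f₂ → Divides P h f₁
  divides-f₂⇒divides-f₁ h h[r]≢0 (q , iq , h·q≡f₂) =
    q′ , iq′ , L*-cancel (pmul P h q′) f₁ (pmul-IsPoly h q′) (pmul-IsPoly L d) L·h·q′≡L·f₁
    where
    h[r]q[r]≡0 : eval h * eval q ≡ₚ 0
    h[r]q[r]≡0 = begin
      eval h * eval q         ≈⟨ eval-pmul h q ⟨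
      eval (pmul P h q)       ≡⟨ cong eval (trans h·q≡f₂ f₂≡L·f₁) ⟩
      eval (pmul P L f₁)      ≈⟨ eval-pmul L f₁ ⟩
      eval L * eval f₁        ≈⟨ *-congₚ {eval L} {0} eval-L ≡ₚ-refl ⟩
      0                       ∎
      where open ≡ₚ-Reasoning
    q[r]≡0 : eval q % P ≡ 0
    q[r]≡0 = decidable-stable (eval q % P ≟ 0)
      (λ q[r]≢0 → *-≢0-mod (eval h) (eval q) h[r]≢0 q[r]≢0 (unₚ h[r]q[r]≡0))
    L∣q    = root⇒L∣ q iq q[r]≡0
    q′     = proj₁ L∣q
    iq′    = proj₁ (proj₂ L∣q)
    L·q′≡q = proj₂ (proj₂ L∣q)
    L·h·q′≡L·f₁ : pmul P L (pmul P h q′) ≡ pmul P L f₁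
    L·h·q′≡L·f₁ = begin
      pmul P L (pmul P h q′)  ≡⟨ pmul-left-comm L h q′ ⟩
      pmul P h (pmul P L q′)  ≡⟨ cong (pmul P h) L·q′≡q ⟩
      pmul P h q              ≡⟨ h·q≡f₂ ⟩
      f₂                      ≡⟨ f₂≡L·f₁ ⟩
      pmul P L f₁             ∎
      where open ≡-Reasoning

  coprime-f₂⇒coprime-f₁ : ∀ g → Coprime P g f₂ → Coprime P g f₁
  coprime-f₂⇒coprime-f₁ g coprime h ih nh h∣g h∣f₁ = coprime h ih nh h∣g (divides-f₁⇒divides-f₂ h h∣f₁)

  coprime-f₁⇒coprime-f₂ : ∀ g → IsPoly P g → Coprime P g f₁ → Coprime P g f₂
  coprime-f₁⇒coprime-f₂ g ig coprime h ih nh h∣g h∣f₂ with eval g % P ≟ 0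
  ... | yes g[r]≡0 = ⊥-elim (1+n≢0 (coprime L L-IsPoly (λ ()) (root⇒L∣ g ig g[r]≡0) (d , d-IsPoly , refl)))
  ... | no g[r]≢0  = coprime h ih nh h∣g (divides-f₂⇒divides-f₁ h (eval-divisor≢0 h g h∣g g[r]≢0) h∣f₂)

  module _ (d≢[] : ¬ d ≡ []) where
    length-f₁ : length f₁ ≡ 2 + deg d
    length-f₁ = length-pmul L d L-IsPoly d-IsPoly (λ ()) d≢[]

    length-f₂ : length f₂ ≡ 3 + deg d
    length-f₂ = trans (length-pmul (pmul P L L) d (pmul-IsPoly L L) d-IsPoly L²≢[] d≢[])
                      (cong (λ n → suc (n ∸ 1 + deg d)) length-L²)
      where
      length-L² : length (pmul P L L) ≡ 3
      length-L² = length-pmul L L L-IsPoly L-IsPoly (λ ()) (λ ())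
      L²≢[] : ¬ pmul P L L ≡ []
      L²≢[] e = 0≢1+n (trans (sym (cong length e)) length-L²)

    f₁≢[] : ¬ f₁ ≡ []
    f₁≢[] e = 0≢1+n (trans (sym (cong length e)) length-f₁)

    -- deg f₁ = deg d + 1 and deg f₂ = deg d + 2 with deg d even, so the two
    -- degree bounds admit the same even degrees.
    InK-f₁⇔InK-f₂ : Even (deg d) → ∀ g → InK P f₁ g ⇔ InK P f₂ g
    InK-f₁⇔InK-f₂ even-d g = mk⇔
      (λ (ig , sr , even-g , g<f₁ , coprime) → ig , sr , even-g , <f₁⇒<f₂ g<f₁ , coprime-f₁⇒coprime-f₂ g ig coprime)
      (λ (ig , sr , even-g , g<f₂ , coprime) → ig , sr , even-g , even<f₂⇒<f₁ even-g g<f₂ , coprime-f₂⇒coprime-f₁ g coprime)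
      where
      deg-f₁ : deg f₁ ≡ 1 + deg d
      deg-f₁ = cong (_∸ 1) length-f₁
      deg-f₂ : deg f₂ ≡ 2 + deg d
      deg-f₂ = cong (_∸ 1) length-f₂
      <f₁⇒<f₂ : ∀ {m} → m < deg f₁ → m < deg f₂
      <f₁⇒<f₂ {m} lt = subst (m <_) (sym deg-f₂) (m≤n⇒m≤1+n (subst (m <_) deg-f₁ lt))
      even<f₂⇒<f₁ : ∀ {m} → Even m → m < deg f₂ → m < deg f₁
      even<f₂⇒<f₁ {m} even-m lt = subst (m <_) (sym deg-f₁) (even<2+even⇒<1+ even-m even-d (subst (m <_) deg-f₂ lt))

-- Finiteness of K(f)

even? : ∀ n → Dec (Even n)
even? n = map′ (λ (divides q n≡q*2) → q , trans n≡q*2 (*-comm q 2))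
               (λ (q , n≡2*q) → divides q (trans n≡2*q (*-comm 2 q)))
               (2 ∣? n)

_≟L_ : (a b : List ℕ) → Dec (a ≡ b)
_≟L_ = ≡-dec _≟_

module Enumeration (k : ℕ) (P-prime : Prime (suc k)) where
  open Modulo k
  open PrimeModulus k P-prime

  coeffLists : ℕ → List (List ℕ)
  coeffLists zero    = [] ∷ []
  coeffLists (suc n) = [] ∷ cartesianProductWith _∷_ (upTo P) (coeffLists n)

  ∈-coeffLists : ∀ n xs → All (_< P) xs → length xs ≤ n → xs ∈ coeffLists n
  ∈-coeffLists zero    []       _          _        = here refl
  ∈-coeffLists (suc n) []       _          _        = here refl
  ∈-coeffLists (suc n) (x ∷ xs) (x< ∷ xs<) (s≤s le) =
    there (∈-cartesianProductWith⁺ _∷_ (∈-upTo⁺ x<) (∈-coeffLists n xs xs< le))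

  IsPoly? : ∀ g → Dec (IsPoly P g)
  IsPoly? g = all? (_<? P) g ×-dec (trim g ≟L g)

  SelfReciprocal? : ∀ g → Dec (SelfReciprocal g)
  SelfReciprocal? g = ¬? (g ≟L []) ×-dec (recip g ≟L g)

  factor-length≤ : ∀ h q → IsPoly P h → IsPoly P q → ¬ h ≡ [] → ¬ pmul P h q ≡ [] →
                   length h ≤ length (pmul P h q) × length q ≤ length (pmul P h q)
  factor-length≤ h []      _  _  _  h·q≢[] = ⊥-elim (h·q≢[] (pmul-[]ʳ h))
  factor-length≤ h (y ∷ q) ih iq h≢[] _ rewrite length-pmul h (y ∷ q) ih iq h≢[] (λ ()) =
    ≤-trans (length≤suc-deg h) (s≤s (m≤m+n (deg h) (length q))) , s≤s (m≤n+m (length q) (deg h))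

  Divides? : ∀ h X → IsPoly P h → ¬ h ≡ [] → ¬ X ≡ [] → Dec (Divides P h X)
  Divides? h X ih h≢[] X≢[] with any? (λ q → IsPoly? q ×-dec (pmul P h q ≟L X)) (coeffLists (length X))
  ... | yes found = yes (satisfied found)
  ... | no  none  = no λ (q , iq , h·q≡X) → none (lose (∈-coeffLists (length X) q (proj₁ iq)
          (subst (λ Y → length q ≤ length Y) h·q≡X
             (proj₂ (factor-length≤ h q ih iq h≢[] (λ e → X≢[] (trans (sym h·q≡X) e))))))
          (iq , h·q≡X))

  module _ (g f : List ℕ) (g≢[] : ¬ g ≡ []) (f≢[] : ¬ f ≡ []) where
    CommonDivisorIsUnit : List ℕ → Set
    CommonDivisorIsUnit h = IsPoly P h → ¬ h ≡ [] → Divides P h g → Divides P h f → deg h ≡ 0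

    CommonDivisorIsUnit? : ∀ h → Dec (CommonDivisorIsUnit h)
    CommonDivisorIsUnit? h with IsPoly? h | h ≟L []
    ... | no ¬ih | _        = yes λ ih → ⊥-elim (¬ih ih)
    ... | yes _  | yes h≡[] = yes λ _ h≢[] → ⊥-elim (h≢[] h≡[])
    ... | yes ih | no h≢[]  = map′ (λ unit _ _ → unit) (λ unit → unit ih h≢[])
      (Divides? h g ih h≢[] g≢[] →-dec Divides? h f ih h≢[] f≢[] →-dec deg h ≟ 0)

    -- A common divisor of g and f is a factor of g, hence among the coefficient
    -- lists of length at most length g.
    Coprime? : Dec (Coprime P g f)
    Coprime? with all? CommonDivisorIsUnit? (coeffLists (length g))
    ... | no  ¬all = no λ coprime → ¬all (All.tabulate (λ {h} _ → coprime h))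
    ... | yes all  = yes λ h ih h≢[] h∣g@(q , iq , h·q≡g) h∣f →
      All.lookup all (∈-coeffLists (length g) h (proj₁ ih)
        (subst (λ Y → length h ≤ length Y) h·q≡g
           (proj₁ (factor-length≤ h q ih iq h≢[] (λ e → g≢[] (trans (sym h·q≡g) e))))))
        ih h≢[] h∣g h∣f

  InK? : ∀ f → ¬ f ≡ [] → ∀ g → Dec (InK P f g)
  InK? f f≢[] g with IsPoly? g | SelfReciprocal? g
  ... | no ¬ig | _       = no λ g∈K → ¬ig (proj₁ g∈K)
  ... | yes _  | no ¬sr  = no λ g∈K → ¬sr (proj₁ (proj₂ g∈K))
  ... | yes ig | yes sr  = map′ (λ rest → ig , sr , rest) (λ g∈K → proj₂ (proj₂ g∈K))
      (even? (deg g) ×-dec deg g <? deg f ×-dec Coprime? g f (proj₁ sr) f≢[])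

  phi-exists : ∀ f → ¬ f ≡ [] → ∃ λ n → PhiIs P f n
  phi-exists f f≢[] = length K , K , deduplicate-! _≟L_ candidates , refl , λ g → mk⇔ (sound g) (complete g)
    where
    candidates = filter (InK? f f≢[]) (coeffLists (length f))
    K = deduplicate _≟L_ candidates
    sound : ∀ g → g ∈ K → InK P f g
    sound g g∈K = proj₂ (∈-filter⁻ (InK? f f≢[]) {xs = coeffLists (length f)} (∈-deduplicate⁻ _≟L_ candidates g∈K))
    length≤ : ∀ g f → deg g < deg f → length g ≤ length f
    length≤ []      _       _  = z≤n
    length≤ (_ ∷ _) (_ ∷ _) lt = s≤s (<⇒≤ lt)
    complete : ∀ g → InK P f g → g ∈ K
    complete g g∈K@(ig , _ , _ , g<f , _) = ∈-deduplicate⁺ _≟L_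
      (∈-filter⁺ (InK? f f≢[]) (∈-coeffLists (length f) g (proj₁ ig) (length≤ g f g<f)) g∈K)

PhiIs-resp-⇔ : ∀ {p f₁ f₂ n} → (∀ g → InK p f₁ g ⇔ InK p f₂ g) → PhiIs p f₁ n → PhiIs p f₂ n
PhiIs-resp-⇔ K₁⇔K₂ (K , unique , length≡n , ∈K⇔K₁) = K , unique , length≡n , λ g →
  mk⇔ (λ g∈K → Equivalence.to (K₁⇔K₂ g) (Equivalence.to (∈K⇔K₁ g) g∈K))
      (λ g∈K₂ → Equivalence.from (∈K⇔K₁ g) (Equivalence.from (K₁⇔K₂ g) g∈K₂))

phi-L·d≡phi-L²·d : ∀ k → Prime (suc k) → ∀ c r → c + r ≡ suc k → IsPoly (suc k) (c ∷ 1 ∷ []) →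
  ∀ d → IsPoly (suc k) d → ¬ d ≡ [] → Even (deg d) →
  let L = c ∷ 1 ∷ [] in
  ∃ λ n → PhiIs (suc k) (pmul (suc k) L d) n × PhiIs (suc k) (pmul (suc k) (pmul (suc k) L L) d) n
phi-L·d≡phi-L²·d k P-prime c r c+r≡P L-IsPoly d d-IsPoly d≢[] even-d =
  n , phi-f₁ , PhiIs-resp-⇔ (InK-f₁⇔InK-f₂ d≢[] even-d) phi-f₁
  where
  open SquareOfLinearFactor k P-prime c r c+r≡P L-IsPoly d d-IsPoly
  open Enumeration k P-prime
  n      = proj₁ (phi-exists f₁ (f₁≢[] d≢[]))
  phi-f₁ = proj₂ (phi-exists f₁ (f₁≢[] d≢[]))

-- Self-reciprocity of d is only needed in the form d ≠ 0.
proposition2 : (p : ℕ) → Prime p → (d : List ℕ) → IsPoly p d →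
    SelfReciprocal d → Even (deg d) →
    (∃ λ n → PhiIs p (pmul p x+1 d) n × PhiIs p (pmul p (pmul p x+1 x+1) d) n)
    × (∃ λ n → PhiIs p (pmul p (x-1 p) d) n
                 × PhiIs p (pmul p (pmul p (x-1 p) (x-1 p)) d) n)
proposition2 zero          p-prime = ⊥-elim (¬prime[0] p-prime)
proposition2 (suc zero)    p-prime = ⊥-elim (¬prime[1] p-prime)
proposition2 (suc (suc j)) p-prime d d-IsPoly (d≢[] , _) even-d =
  phi-L·d≡phi-L²·d (suc j) p-prime 1 (suc j) refl ((1<p ∷ 1<p ∷ []) , refl) d d-IsPoly d≢[] even-d ,
  phi-L·d≡phi-L²·d (suc j) p-prime (suc j) 1 (+-comm (suc j) 1) ((≤-refl ∷ 1<p ∷ []) , refl) d d-IsPoly d≢[] even-d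
  where
  1<p : 1 < suc (suc j)
  1<p = s≤s (s≤s z≤n)
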